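{- Let $G=(L,R,E)$ be a finite bipartite graph that has an $L$-saturating matching, and whose vertex set $R$ is equipped with a linear ordering. Then there exists a linear ordering $\succ$ of the vertices of $L$ such that the greedy matching $M^\succ_G$ is an $L$-saturating matching of minimum order among all matchings of $G$.
   Context: Let $y_1\succ y_2\succ\dots\succ y_N$ be the vertices of $R$ listed in order of preference. A matching $M$ is $L$-saturating if every vertex of $L$ is matched by $M$. The order of a matching $M$ is the smallest $k$ such that $M$ is $L$-saturating and leaves $y_{k+1},\dots,y_N$ unmatched; if $M$ is not $L$-saturating its order is $\infty$. Given a linear ordering $\succ$ of $L$, the greedy matching $M^\succ_G$ is the matching produced by the following procedure: start with $M=\emptyset$; while $M$ is not a maximal matching, let $L_M$ be the set of vertices of $L$ unmatched by $M$ that are adjacent to some vertex of $R$ unmatched by $M$, $R_M$ analogously, let $x^*$ be the most preferred vertex of $L_M$, let $y^*$ be the most preferred vertex of $R_M$ adjacent to $x^*$, and add the edge $\{x^*,y^*\}$ to $M$; return $M$ when it is maximal. -}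

module Defs where

open import Data.Nat using (ℕ; zero; suc; _<_; _≤_)
open import Data.Fin using (Fin; toℕ; _≟_)
open import Data.Fin.Permutation using (Permutation′; _⟨$⟩ˡ_)
open import Data.Bool using (Bool; true; false; not; _∧_; if_then_else_)
open import Data.Maybe using (Maybe; just; nothing; is-nothing)
open import Data.List using (List; []; _∷_; map)
open import Data.Bool.ListAction using (any)
open import Data.List.Base using (allFin)
open import Data.Product using (Σ; ∃; _×_; _,_)
open import Relation.Nullary.Decidable using (⌊_⌋)
open import Relation.Binary.PropositionalEquality using (_≡_)

-- Convention: R = Fin n is listed in order of preference:
-- y_1 ≻ y_2 ≻ … ≻ y_N corresponds to 0, 1, …, n-1 (smaller index = more preferred).
BipGraph : ℕ → ℕ → Set
BipGraph m n = Fin m → Fin n → Bool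

-- A set of edges in which every vertex of L has at most one partner is
-- represented by the partner function  M : L → Maybe R.
Assign : ℕ → ℕ → Set
Assign m n = Fin m → Maybe (Fin n)

record IsMatching {m n : ℕ} (E : BipGraph m n) (M : Assign m n) : Set where
  field
    edges : ∀ x y → M x ≡ just y → E x y ≡ true
    injective : ∀ x x' y → M x ≡ just y → M x' ≡ just y → x ≡ x'

Saturating : {m n : ℕ} → Assign m n → Set
Saturating {m} {n} M = ∀ (x : Fin m) → ∃ λ (y : Fin n) → M x ≡ just y

-- M is L-saturating and leaves y_{k+1}, …, y_N unmatched
-- (i.e. every matched vertex of R has 0-based index < k)
OrderAtMost : {m n : ℕ} → Assign m n → ℕ → Set
OrderAtMost {m} {n} M k = ∀ (x : Fin m) → ∃ λ (y : Fin n) → M x ≡ just y × toℕ y < k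

-- the order of M is k: the smallest k with OrderAtMost M k
-- (a matching with no such k has order ∞ and satisfies HasOrder for no k)
HasOrder : {m n : ℕ} → Assign m n → ℕ → Set
HasOrder M k = OrderAtMost M k × (∀ j → OrderAtMost M j → k ≤ j)

first : {A : Set} → (A → Bool) → List A → Maybe A
first p [] = nothing
first p (a ∷ as) = if p a then just a else first p as

matchesTo : {n : ℕ} → Maybe (Fin n) → Fin n → Bool
matchesTo nothing y = false
matchesTo (just y') y = ⌊ y' ≟ y ⌋

freeL : {m n : ℕ} → Assign m n → Fin m → Bool
freeL M x = is-nothing (M x)

freeR : {m n : ℕ} → Assign m n → Fin n → Bool
freeR {m} M y = not (any (λ x → matchesTo (M x) y) (allFin m))

inLM : {m n : ℕ} → BipGraph m n → Assign m n → Fin m → Bool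
inLM {m} {n} E M x = freeL M x ∧ any (λ y → E x y ∧ freeR M y) (allFin n)

addEdge : {m n : ℕ} → Assign m n → Fin m → Fin n → Assign m n
addEdge M x y x' = if ⌊ x' ≟ x ⌋ then just y else M x'

-- A linear ordering ≻ of L is given by a permutation π of Fin m:
-- the i-th most preferred vertex of L (0-based) is  π ⟨$⟩ˡ i.
-- One step of the greedy procedure; returns nothing iff L_M is empty,
-- i.e. iff M is a maximal matching.
greedyStep : {m n : ℕ} → BipGraph m n → Permutation′ m → Assign m n → Maybe (Assign m n)
greedyStep {m} {n} E π M with first (inLM E M) (map (π ⟨$⟩ˡ_) (allFin m))
... | nothing = nothing
... | just x with first (λ y → E x y ∧ freeR M y) (allFin n)
...   | nothing = nothing
...   | just y = just (addEdge M x y)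

-- iterate the loop; each iteration matches one more vertex of L, so
-- m iterations suffice to reach a maximal matching
greedyRun : {m n : ℕ} → BipGraph m n → Permutation′ m → ℕ → Assign m n → Assign m n
greedyRun E π zero M = M
greedyRun E π (suc k) M with greedyStep E π M
... | nothing = M
... | just M' = greedyRun E π k M'

greedy : {m n : ℕ} → BipGraph m n → Permutation′ m → Assign m n
greedy {m} E π = greedyRun E π m (λ _ → nothing)

-- Choose an L-saturating matching f : L → R whose set S of used vertices minimises
-- Σ_{y_i ∈ S} 2^i; comparing these sums compares two sets by the largest index at which
-- they differ. Order L by increasing partner f x. If x had a free neighbour y better than
-- f x, moving x to y would lower the sum; so every better neighbour of x is matched to a
-- vertex preceding x, and the greedy procedure, processing L in this order, matches each
-- x to f x. Finally, a saturating matching of order j has sum below 2^j, whereas a matching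
-- using some y_i with i ≥ j has sum at least 2^j; by minimality, f has order at most j.
module Submission where

open import Defs
open import Data.Bool as Bool using (Bool; true; false; not; _∧_)
open import Data.Bool.Properties using (∨-zeroʳ)
open import Data.Bool.ListAction using (any)
open import Data.Fin as Fin using (Fin; zero; suc; toℕ; fromℕ<; punchOut)
open import Data.Fin.Properties
  using (any?; all?; _≟_; _<?_; <-cmp; <-irrefl; <-trans; <⇒≢; toℕ-injective; toℕ-fromℕ<; toℕ<n;
         punchOut-injective; injective⇒≤)
open import Data.Fin.Permutation
  using (Permutation′; _⟨$⟩ʳ_; _⟨$⟩ˡ_; permutation; inverseˡ; inverseʳ)
open import Data.Fin.Subset using (Subset; _∈_; _⊂_; ⊤; ∣_∣)
open import Data.Fin.Subset.Properties using (p⊂q⇒∣p∣<∣q∣; ∣⊤∣≡n; ∈⊤)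
open import Data.List using (tabulate; map; allFin)
open import Data.List.Properties using (map-tabulate)
open import Data.Maybe using (just; nothing)
open import Data.Maybe.Properties using (just-injective)
open import Data.Nat using (ℕ; zero; suc; _+_; _^_; _≤_; _<_; s≤s⁻¹; z<s; s<s)
open import Data.Nat.Induction using (<-wellFounded)
import Data.Nat.Properties as ℕ
open import Data.Nat.Properties using (anyUpTo?)
open import Data.Product using (Σ; ∃; _×_; _,_; proj₁; proj₂)
open import Data.Sum using (inj₁; inj₂)
import Data.Vec as Vec
open import Data.Vec.Properties using (lookup∘tabulate; lookup⇒[]=; []=⇒lookup)
open import Data.Vec.Functional using (_∷_; head; tail; updateAt)
open import Data.Vec.Functional.Properties using (updateAt-updates; updateAt-minimal)
open import Function using (_∘_; const; id)
open import Function.Definitions using (Injective)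
open import Induction.WellFounded using (Acc; acc)
open import Relation.Binary using (tri<; tri≈; tri>)
open import Relation.Binary.PropositionalEquality
  using (_≡_; _≢_; _≗_; refl; sym; trans; cong; cong₂; subst; subst₂)
open import Relation.Nullary using (Dec; yes; no; ¬_; contradiction; does)
open import Relation.Nullary.Decidable
  using (map′; _×-dec_; _→-dec_; isYes≗does; dec-true; dec-false)
open import Relation.Unary using (Decidable)

first-tabulate : ∀ {A : Set} {k} (p : A → Bool) (h : Fin k → A) {i : Fin k} →
                 (∀ {j} → j Fin.< i → p (h j) ≡ false) → p (h i) ≡ true →
                 first p (tabulate h) ≡ just (h i)
first-tabulate p h {zero}  _    hit rewrite hit = refl
first-tabulate p h {suc i} miss hit rewrite miss {zero} z<s =
  first-tabulate p (h ∘ suc) (λ j<i → miss (s<s j<i)) hit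

any-tabulate-true : ∀ {A : Set} {k} (p : A → Bool) (h : Fin k → A) (i : Fin k) →
                    p (h i) ≡ true → any p (tabulate h) ≡ true
any-tabulate-true p h zero    hit rewrite hit = refl
any-tabulate-true p h (suc i) hit
  rewrite any-tabulate-true p (h ∘ suc) i hit = ∨-zeroʳ (p (h zero))

any-tabulate-false : ∀ {A : Set} {k} (p : A → Bool) (h : Fin k → A) →
                     (∀ i → p (h i) ≡ false) → any p (tabulate h) ≡ false
any-tabulate-false {k = zero}  p h miss = refl
any-tabulate-false {k = suc k} p h miss
  rewrite miss zero = any-tabulate-false p (h ∘ suc) (miss ∘ suc)

module _ {m n} (M : Assign m n) {y : Fin n} where

  freeR-matched : ∀ {x} → M x ≡ just y → freeR M y ≡ false
  freeR-matched {x} Mx≡y = cong not (any-tabulate-true _ id x matches)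
    where
    matches : matchesTo (M x) y ≡ true
    matches rewrite Mx≡y = trans (isYes≗does (y ≟ y)) (dec-true (y ≟ y) refl)

  freeR-unmatched : (∀ x → M x ≢ just y) → freeR M y ≡ true
  freeR-unmatched unmatched = cong not (any-tabulate-false _ id misses)
    where
    misses : ∀ x → matchesTo (M x) y ≡ false
    misses x with M x in Mx≡
    ... | nothing = refl
    ... | just y′ =
      trans (isYes≗does (y′ ≟ y)) (dec-false (y′ ≟ y) λ { refl → unmatched x Mx≡ })

module _ {U : ℕ → Set} (U? : Decidable U) where

  weight : ℕ → ℕ
  weight zero = 0
  weight (suc k) with U? k
  ... | yes _ = weight k + 2 ^ k
  ... | no _  = weight k

  weight-<2^ : ∀ k → weight k < 2 ^ k
  weight-<2^ zero = z<s
  weight-<2^ (suc k) with U? k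
  ... | yes _ = begin-strict
    weight k + 2 ^ k  <⟨ ℕ.+-monoˡ-< (2 ^ k) (weight-<2^ k) ⟩
    2 ^ k + 2 ^ k     ≡⟨ cong (2 ^ k +_) (ℕ.+-identityʳ (2 ^ k)) ⟨
    2 ^ suc k         ∎
    where open ℕ.≤-Reasoning
  ... | no _  = ℕ.<-≤-trans (weight-<2^ k) (ℕ.^-monoʳ-≤ 2 (ℕ.n≤1+n k))

  weight-≤-suc : ∀ k → weight k ≤ weight (suc k)
  weight-≤-suc k with U? k
  ... | yes _ = ℕ.m≤m+n _ _
  ... | no _  = ℕ.≤-refl

  2^≤weight : ∀ {i} → U i → ∀ {k} → i < k → 2 ^ i ≤ weight k
  2^≤weight {i} ui {suc k} i<1+k with ℕ.m≤n⇒m<n∨m≡n (s≤s⁻¹ i<1+k)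
  ... | inj₁ i<k = ℕ.≤-trans (2^≤weight ui i<k) (weight-≤-suc k)
  ... | inj₂ refl with U? i
  ...   | yes _   = ℕ.m≤n+m _ _
  ...   | no ¬ui  = contradiction ui ¬ui

  weight-<2^-bounded : ∀ {j} → (∀ {i} → U i → i < j) → ∀ k → weight k < 2 ^ j
  weight-<2^-bounded {j} bounded zero = ℕ.m^n>0 2 j
  weight-<2^-bounded {j} bounded (suc k) with j ℕ.≤? k
  ... | no j≰k = ℕ.<-≤-trans (weight-<2^ (suc k)) (ℕ.^-monoʳ-≤ 2 (ℕ.≰⇒> j≰k))
  ... | yes j≤k with U? k
  ...   | yes uk = contradiction (bounded uk) (ℕ.≤⇒≯ j≤k)
  ...   | no _   = weight-<2^-bounded bounded k

module _ {U V : ℕ → Set} (U? : Decidable U) (V? : Decidable V) where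

  weight-cong : (∀ {i} → U i → V i) → (∀ {i} → V i → U i) →
                ∀ k → weight U? k ≡ weight V? k
  weight-cong U⇒V V⇒U zero = refl
  weight-cong U⇒V V⇒U (suc k) with U? k | V? k
  ... | yes _  | yes _  = cong (_+ 2 ^ k) (weight-cong U⇒V V⇒U k)
  ... | no _   | no _   = weight-cong U⇒V V⇒U k
  ... | yes uk | no ¬vk = contradiction (U⇒V uk) ¬vk
  ... | no ¬uk | yes vk = contradiction (V⇒U vk) ¬uk

  weight-<-largestDifference : ∀ {t} → U t → ¬ V t → (∀ {i} → t < i → V i → U i) →
                               ∀ {k} → t < k → weight V? k < weight U? k
  weight-<-largestDifference {t} ut ¬vt above {suc k} t<1+k
    with ℕ.m≤n⇒m<n∨m≡n (s≤s⁻¹ t<1+k)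
  ... | inj₂ refl with U? t | V? t
  ...   | yes _  | no _  = ℕ.<-≤-trans (weight-<2^ V? t) (ℕ.m≤n+m _ _)
  ...   | no ¬ut | _     = contradiction ut ¬ut
  ...   | yes _  | yes vt = contradiction vt ¬vt
  weight-<-largestDifference ut ¬vt above {suc k} _ | inj₁ t<k
    with U? k | V? k | weight-<-largestDifference ut ¬vt above t<k
  ... | yes _  | yes _  | ih = ℕ.+-monoˡ-< _ ih
  ... | yes _  | no _   | ih = ℕ.<-≤-trans ih (ℕ.m≤m+n _ _)
  ... | no _   | no _   | ih = ih
  ... | no ¬uk | yes vk | _  = contradiction (above t<k vk) ¬uk

argmin : ∀ {A : Set} (μ : A → ℕ) {P : A → Set} →
         (∀ k → Dec (∃ λ a → μ a < k × P a)) →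
         ∀ {a} → P a → ∃ λ b → P b × (∀ {c} → P c → μ b ≤ μ c)
argmin {A} μ {P} smaller? {a} pa = descend a pa (<-wellFounded (μ a))
  where
  descend : ∀ a → P a → Acc _<_ (μ a) → ∃ λ b → P b × (∀ {c} → P c → μ b ≤ μ c)
  descend a pa (acc rec) with smaller? (μ a)
  ... | yes (b , μb<μa , pb) = descend b pb (rec μb<μa)
  ... | no none = a , pa , λ {c} pc → ℕ.≮⇒≥ (λ μc<μa → none (c , μc<μa , pc))

anyFunction? : ∀ {m n} {P : (Fin m → Fin n) → Set} →
               (∀ {f g} → f ≗ g → P f → P g) → Decidable P → Dec (∃ P)
anyFunction? {zero} resp P? =
  map′ (λ p → _ , p) (λ (f , pf) → resp (λ ()) pf) (P? (λ ()))
anyFunction? {suc m} resp P? =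
  map′ (λ (a , g , p) → a ∷ g , p)
       (λ (f , pf) → head f , tail f , resp (λ { zero → refl ; (suc i) → refl }) pf)
       (any? λ a → anyFunction? (λ f≗g → resp λ { zero → refl ; (suc i) → f≗g i })
                                (P? ∘ (a ∷_)))

module _ {n} {P : Fin n → Set} (P? : Decidable P) where

  subsetOf : Subset n
  subsetOf = Vec.tabulate (does ∘ P?)

  ∈-subsetOf⁺ : ∀ {x} → P x → x ∈ subsetOf
  ∈-subsetOf⁺ {x} px =
    lookup⇒[]= x subsetOf (trans (lookup∘tabulate _ x) (dec-true (P? x) px))

  ∈-subsetOf⁻ : ∀ {x} → x ∈ subsetOf → P x
  ∈-subsetOf⁻ {x} x∈ = witness (trans (sym (lookup∘tabulate _ x)) ([]=⇒lookup x∈))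
    where
    witness : does (P? x) ≡ true → P x
    witness _ with P? x
    witness _  | yes px = px
    witness () | no _

injective⇒surjective : ∀ {m} {h : Fin m → Fin m} → Injective _≡_ _≡_ h →
                       ∀ i → ∃ λ x → h x ≡ i
injective⇒surjective {suc m} {h} h-inj i with any? (λ x → h x ≟ i)
... | yes hit = hit
... | no miss = contradiction (injective⇒≤ h′-inj) ℕ.1+n≰n
  where
  avoids : ∀ x → i ≢ h x
  avoids x i≡hx = miss (x , sym i≡hx)

  h′ : Fin (suc m) → Fin m
  h′ x = punchOut (avoids x)

  h′-inj : Injective _≡_ _≡_ h′
  h′-inj {x} {y} = h-inj ∘ punchOut-injective (avoids x) (avoids y)

Sorts : ∀ {m n} → (Fin m → Fin n) → Permutation′ m → Set
Sorts f π = ∀ {x x′} → f x Fin.< f x′ → π ⟨$⟩ʳ x Fin.< π ⟨$⟩ʳ x′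

module _ {m n} {f : Fin m → Fin n} (f-inj : Injective _≡_ _≡_ f) where
  private
    below? : ∀ x → Decidable (λ x′ → f x′ Fin.< f x)
    below? x x′ = f x′ <? f x

    below : Fin m → Subset m
    below x = subsetOf (below? x)

    ∉-below : ∀ x → ¬ x ∈ below x
    ∉-below x x∈ = <-irrefl refl (∈-subsetOf⁻ (below? x) x∈)

    below-⊂ : ∀ {x x′} → f x Fin.< f x′ → below x ⊂ below x′
    below-⊂ {x} {x′} fx<fx′ =
      (λ z∈ → ∈-subsetOf⁺ (below? x′) (<-trans (∈-subsetOf⁻ (below? x) z∈) fx<fx′)) ,
      x , ∈-subsetOf⁺ (below? x′) fx<fx′ , ∉-below x

    rank-< : ∀ x → ∣ below x ∣ < m
    rank-< x =
      subst (∣ below x ∣ <_) (∣⊤∣≡n m) (p⊂q⇒∣p∣<∣q∣ ((λ _ → ∈⊤) , x , ∈⊤ , ∉-below x))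

    rank : Fin m → Fin m
    rank x = fromℕ< (rank-< x)

    rank-mono : ∀ {x x′} → f x Fin.< f x′ → rank x Fin.< rank x′
    rank-mono {x} {x′} fx<fx′ =
      subst₂ _<_ (sym (toℕ-fromℕ< (rank-< x))) (sym (toℕ-fromℕ< (rank-< x′)))
             (p⊂q⇒∣p∣<∣q∣ (below-⊂ fx<fx′))

    rank-injective : Injective _≡_ _≡_ rank
    rank-injective {x} {x′} eq with <-cmp (f x) (f x′)
    ... | tri< lt _ _ = contradiction eq (<⇒≢ (rank-mono lt))
    ... | tri≈ _ e _  = f-inj e
    ... | tri> _ _ gt = contradiction (sym eq) (<⇒≢ (rank-mono gt))

    rank-surjective : ∀ i → ∃ λ x → rank x ≡ i
    rank-surjective = injective⇒surjective rank-injective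

  sortingPermutation : Σ (Permutation′ m) (Sorts f)
  sortingPermutation =
    permutation rank (proj₁ ∘ rank-surjective) (proj₂ ∘ rank-surjective)
                (λ x → rank-injective (proj₂ (rank-surjective (rank x)))) ,
    rank-mono

record IsSaturatingMatching {m n} (E : BipGraph m n) (f : Fin m → Fin n) : Set where
  field
    edge      : ∀ x → E x (f x) ≡ true
    injective : Injective _≡_ _≡_ f

BetterNeighboursMatched : ∀ {m n} → BipGraph m n → (Fin m → Fin n) → Set
BetterNeighboursMatched E f = ∀ {x y} → E x y ≡ true → y Fin.< f x → ∃ λ x′ → f x′ ≡ y

module _ {m n} {E : BipGraph m n} where

  isSaturatingMatching? : Decidable (IsSaturatingMatching E)
  isSaturatingMatching? f =
    map′ (λ (edge , inj) → record { edge = edge ; injective = λ {x} {x′} → inj x x′ })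
         (λ sm → IsSaturatingMatching.edge sm , λ x x′ → IsSaturatingMatching.injective sm)
         (all? (λ x → E x (f x) Bool.≟ true) ×-dec
          all? (λ x → all? λ x′ → (f x ≟ f x′) →-dec (x ≟ x′)))

  IsSaturatingMatching-resp : ∀ {f g} → f ≗ g →
                              IsSaturatingMatching E f → IsSaturatingMatching E g
  IsSaturatingMatching-resp f≗g sm = record
    { edge      = λ x → subst (λ y → E x y ≡ true) (f≗g x) (edge x)
    ; injective = λ gx≡gx′ → injective (trans (f≗g _) (trans gx≡gx′ (sym (f≗g _))))
    }
    where open IsSaturatingMatching sm

  updateAt-isSaturatingMatching : ∀ {f x y} → IsSaturatingMatching E f → E x y ≡ true →
                                  (∀ x′ → f x′ ≢ y) →
                                  IsSaturatingMatching E (updateAt f x (const y))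
  updateAt-isSaturatingMatching {f} {x} {y} sm exy unused =
    record { edge = edge′ ; injective = injective′ }
    where
    open IsSaturatingMatching sm

    g : Fin m → Fin n
    g = updateAt f x (const y)

    edge′ : ∀ x′ → E x′ (g x′) ≡ true
    edge′ x′ with x′ ≟ x
    ... | yes refl rewrite updateAt-updates x {const y} f = exy
    ... | no x′≢x  rewrite updateAt-minimal x′ x {const y} f x′≢x = edge x′

    injective′ : Injective _≡_ _≡_ g
    injective′ {x₁} {x₂} gx₁≡gx₂ with x₁ ≟ x | x₂ ≟ x
    ... | yes x₁≡x | yes x₂≡x = trans x₁≡x (sym x₂≡x)
    ... | yes refl | no x₂≢x
      rewrite updateAt-updates x {const y} f | updateAt-minimal x₂ x {const y} f x₂≢x
      = contradiction (sym gx₁≡gx₂) (unused x₂)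
    ... | no x₁≢x  | yes refl
      rewrite updateAt-updates x {const y} f | updateAt-minimal x₁ x {const y} f x₁≢x
      = contradiction gx₁≡gx₂ (unused x₁)
    ... | no x₁≢x  | no x₂≢x
      rewrite updateAt-minimal x₁ x {const y} f x₁≢x
            | updateAt-minimal x₂ x {const y} f x₂≢x
      = injective gx₁≡gx₂

  partnerFunction : ∀ {M : Assign m n} → IsMatching E M → Saturating M →
                    Σ (Fin m → Fin n) λ f → IsSaturatingMatching E f × M ≗ just ∘ f
  partnerFunction {M} isM sat = proj₁ ∘ sat , sm , proj₂ ∘ sat
    where
    open IsMatching isM
    sm : IsSaturatingMatching E (proj₁ ∘ sat)
    sm = record
      { edge      = λ x → edges x _ (proj₂ (sat x))
      ; injective = λ {x} {x′} fx≡fx′ →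
          injective x x′ _ (proj₂ (sat x))
                    (subst (λ y → M x′ ≡ just y) (sym fx≡fx′) (proj₂ (sat x′)))
      }

  partnerFunction⇒isMatching : ∀ {M : Assign m n} {f} → IsSaturatingMatching E f →
                       M ≗ just ∘ f → IsMatching E M
  partnerFunction⇒isMatching {f = f} sm M≡f = record
    { edges     = λ x y Mx≡y → subst (λ y → E x y ≡ true) (partner Mx≡y) (edge x)
    ; injective = λ x x′ y Mx≡y Mx′≡y →
                    injective (trans (partner Mx≡y) (sym (partner Mx′≡y)))
    }
    where
    open IsSaturatingMatching sm
    partner : ∀ {x y} → _ ≡ just y → f x ≡ y
    partner {x} Mx≡y = just-injective (trans (sym (M≡f x)) Mx≡y)

ImageBelow : ∀ {m n} → (Fin m → Fin n) → ℕ → Set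
ImageBelow f j = ∀ x → toℕ (f x) < j

module _ {m n} {M : Assign m n} {j : ℕ} where

  orderAtMost⇒saturating : OrderAtMost M j → Saturating M
  orderAtMost⇒saturating o x = proj₁ (o x) , proj₁ (proj₂ (o x))

  orderAtMost⇒imageBelow : ∀ {f} → M ≗ just ∘ f → OrderAtMost M j → ImageBelow f j
  orderAtMost⇒imageBelow M≡f o x with o x
  ... | y , Mx≡y , y<j =
    subst (λ z → toℕ z < j) (just-injective (trans (sym Mx≡y) (M≡f x))) y<j

  imageBelow⇒orderAtMost : ∀ {f} → M ≗ just ∘ f → ImageBelow f j → OrderAtMost M j
  imageBelow⇒orderAtMost {f} M≡f below x = f x , M≡f x , below x

module _ {m n} (f : Fin m → Fin n) where

  Uses : ℕ → Set
  Uses i = ∃ λ x → toℕ (f x) ≡ i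

  uses? : Decidable Uses
  uses? i = any? λ x → toℕ (f x) ℕ.≟ i

  cost : ℕ
  cost = weight uses? n

  cost-<2^ : ∀ {j} → ImageBelow f j → cost < 2 ^ j
  cost-<2^ {j} below =
    weight-<2^-bounded uses? (λ (x , fx≡i) → subst (_< j) fx≡i (below x)) n

  2^≤cost : ∀ x → 2 ^ toℕ (f x) ≤ cost
  2^≤cost x = 2^≤weight uses? (x , refl) (toℕ<n (f x))

cost-cong : ∀ {m n} {f g : Fin m → Fin n} → f ≗ g → cost f ≡ cost g
cost-cong {n = n} {f} {g} f≗g = weight-cong (uses? f) (uses? g)
  (λ (x , fx≡i) → x , trans (cong toℕ (sym (f≗g x))) fx≡i)
  (λ (x , gx≡i) → x , trans (cong toℕ (f≗g x)) gx≡i) n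

cost-updateAt-< : ∀ {m n} {f : Fin m → Fin n} {x y} →
                  Injective _≡_ _≡_ f → y Fin.< f x →
                  cost (updateAt f x (const y)) < cost f
cost-updateAt-< {f = f} {x} {y} f-inj y<fx =
  weight-<-largestDifference (uses? f) (uses? g) (x , refl) fx-unused above (toℕ<n (f x))
  where
  g : Fin _ → Fin _
  g = updateAt f x (const y)

  fx-unused : ¬ Uses g (toℕ (f x))
  fx-unused (x′ , gx′≡fx) with x′ ≟ x
  ... | yes refl rewrite updateAt-updates x {const y} f = <-irrefl (toℕ-injective gx′≡fx) y<fx
  ... | no x′≢x  rewrite updateAt-minimal x′ x {const y} f x′≢x =
    x′≢x (f-inj (toℕ-injective gx′≡fx))

  above : ∀ {i} → toℕ (f x) < i → Uses g i → Uses f i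
  above fx<i (x′ , gx′≡i) with x′ ≟ x
  ... | yes refl rewrite updateAt-updates x {const y} f =
    contradiction (subst (toℕ (f x) <_) (sym gx′≡i) fx<i) (ℕ.<⇒≯ y<fx)
  ... | no x′≢x  rewrite updateAt-minimal x′ x {const y} f x′≢x = x′ , gx′≡i

module _ {m n} (E : BipGraph m n) where

  MinimalCost : (Fin m → Fin n) → Set
  MinimalCost f =
    IsSaturatingMatching E f × (∀ {g} → IsSaturatingMatching E g → cost f ≤ cost g)

  minimalCost-exists : ∀ {f} → IsSaturatingMatching E f → ∃ MinimalCost
  minimalCost-exists = argmin cost λ k →
    anyFunction? (λ f≗g (cf<k , sm) →
                   subst (_< k) (cost-cong f≗g) cf<k , IsSaturatingMatching-resp f≗g sm)
                 (λ g → (cost g ℕ.<? k) ×-dec isSaturatingMatching? g)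

  minimalCost⇒betterNeighboursMatched : ∀ {f} → MinimalCost f → BetterNeighboursMatched E f
  minimalCost⇒betterNeighboursMatched {f} (sm , minimal) {x} {y} exy y<fx
    with any? (λ x′ → f x′ ≟ y)
  ... | yes matched = matched
  ... | no unmatched =
    contradiction (minimal (updateAt-isSaturatingMatching sm exy λ x′ fx′≡y → unmatched (x′ , fx′≡y)))
                  (ℕ.<⇒≱ (cost-updateAt-< (IsSaturatingMatching.injective sm) y<fx))

  minimalCost-imageBelow : ∀ {f g j} → MinimalCost f →
                           IsSaturatingMatching E g → ImageBelow g j → ImageBelow f j
  minimalCost-imageBelow {f} {g} {j} (_ , minimal) smg g-below x with toℕ (f x) ℕ.<? j
  ... | yes fx<j = fx<j
  ... | no fx≮j  = contradiction (cost-<2^ g g-below) (ℕ.≤⇒≯ (begin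
    2 ^ j           ≤⟨ ℕ.^-monoʳ-≤ 2 (ℕ.≮⇒≥ fx≮j) ⟩
    2 ^ toℕ (f x)   ≤⟨ 2^≤cost f x ⟩
    cost f          ≤⟨ minimal smg ⟩
    cost g          ∎))
    where open ℕ.≤-Reasoning

greedyStep-picks : ∀ {m n} {E : BipGraph m n} {π M x y} →
                   first (inLM E M) (map (π ⟨$⟩ˡ_) (allFin m)) ≡ just x →
                   first (λ y′ → E x y′ ∧ freeR M y′) (allFin n) ≡ just y →
                   greedyStep E π M ≡ just (addEdge M x y)
greedyStep-picks picks-x picks-y rewrite picks-x | picks-y = refl

module GreedyReconstruction {m n} {E : BipGraph m n} {f} (sm : IsSaturatingMatching E f)
  (betterNeighboursMatched : BetterNeighboursMatched E f)
  {π : Permutation′ m} (π-sorts : Sorts f π) where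

  open IsSaturatingMatching sm

  position : Fin m → ℕ
  position x = toℕ (π ⟨$⟩ʳ x)

  position-⟨$⟩ˡ : ∀ i → position (π ⟨$⟩ˡ i) ≡ toℕ i
  position-⟨$⟩ˡ i = cong toℕ (inverseʳ π)

  position-injective : ∀ {x x′} → position x ≡ position x′ → x ≡ x′
  position-injective {x} {x′} eq =
    trans (sym (inverseˡ π)) (trans (cong (π ⟨$⟩ˡ_) (toℕ-injective eq)) (inverseˡ π))

  -- The state of the greedy procedure after t steps.
  matchedBefore : ℕ → Assign m n
  matchedBefore t x with position x ℕ.<? t
  ... | yes _ = just (f x)
  ... | no _  = nothing

  matchedBefore-< : ∀ {t x} → position x < t → matchedBefore t x ≡ just (f x)
  matchedBefore-< {t} {x} p<t with position x ℕ.<? t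
  ... | yes _  = refl
  ... | no p≮t = contradiction p<t p≮t

  matchedBefore-≮ : ∀ {t x} → ¬ position x < t → matchedBefore t x ≡ nothing
  matchedBefore-≮ {t} {x} p≮t with position x ℕ.<? t
  ... | yes p<t = contradiction p<t p≮t
  ... | no _    = refl

  matchedBefore-just : ∀ {t x y} → matchedBefore t x ≡ just y → position x < t × f x ≡ y
  matchedBefore-just {t} {x} eq with position x ℕ.<? t
  matchedBefore-just refl | yes p<t = p<t , refl
  matchedBefore-just ()   | no _

  matchedBefore-suc : ∀ {t x} → position x ≢ t →
                      matchedBefore t x ≡ matchedBefore (suc t) x
  matchedBefore-suc {t} {x} p≢t with position x ℕ.<? t | position x ℕ.<? suc t
  ... | yes _   | yes _     = refl
  ... | no _    | no _      = refl
  ... | yes p<t | no p≮1+t  = contradiction (ℕ.m<n⇒m<1+n p<t) p≮1+t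
  ... | no p≮t  | yes p<1+t = contradiction (ℕ.≤-antisym (s≤s⁻¹ p<1+t) (ℕ.≮⇒≥ p≮t)) p≢t

  module Step {t} (t<m : t < m) {M : Assign m n} (M≗ : M ≗ matchedBefore t) where

    v : Fin m
    v = π ⟨$⟩ˡ fromℕ< t<m

    position-v : position v ≡ t
    position-v = trans (position-⟨$⟩ˡ _) (toℕ-fromℕ< t<m)

    fv-free : freeR M (f v) ≡ true
    fv-free = freeR-unmatched M λ x Mx≡fv →
      let p<t , fx≡fv = matchedBefore-just (trans (sym (M≗ x)) Mx≡fv)
      in ℕ.<-irrefl (trans (cong position (injective fx≡fv)) position-v) p<t

    picks-v : first (inLM E M) (map (π ⟨$⟩ˡ_) (allFin m)) ≡ just v
    picks-v = trans (cong (first (inLM E M)) (map-tabulate id (π ⟨$⟩ˡ_)))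
                    (first-tabulate (inLM E M) (π ⟨$⟩ˡ_) earlier-matched v-eligible)
      where
      earlier-matched : ∀ {j} → j Fin.< fromℕ< t<m → inLM E M (π ⟨$⟩ˡ j) ≡ false
      earlier-matched {j} j<t
        rewrite M≗ (π ⟨$⟩ˡ j)
              | matchedBefore-< {t} {π ⟨$⟩ˡ j}
                  (subst₂ _<_ (sym (position-⟨$⟩ˡ j)) (toℕ-fromℕ< t<m) j<t) = refl

      v-eligible : inLM E M v ≡ true
      v-eligible rewrite M≗ v | matchedBefore-≮ {t} {v} (ℕ.<-irrefl position-v) =
        any-tabulate-true _ id (f v) (cong₂ _∧_ (edge v) fv-free)

    picks-fv : first (λ y → E v y ∧ freeR M y) (allFin n) ≡ just (f v)
    picks-fv = first-tabulate _ id better-unavailable (cong₂ _∧_ (edge v) fv-free)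
      where
      better-unavailable : ∀ {y} → y Fin.< f v → (E v y ∧ freeR M y) ≡ false
      better-unavailable {y} y<fv with E v y in evy
      ... | false = refl
      ... | true with betterNeighboursMatched evy y<fv
      ...   | x′ , refl = freeR-matched M (trans (M≗ x′) (matchedBefore-< x′-earlier))
        where
        x′-earlier : position x′ < t
        x′-earlier = subst (position x′ <_) position-v (π-sorts y<fv)

    step : greedyStep E π M ≡ just (addEdge M v (f v))
    step = greedyStep-picks {E = E} {π} {M} picks-v picks-fv

    next : addEdge M v (f v) ≗ matchedBefore (suc t)
    next x with x ≟ v
    ... | yes refl = sym (matchedBefore-< (subst (_< suc t) (sym position-v) (ℕ.n<1+n t)))
    ... | no x≢v   = trans (M≗ x) (matchedBefore-suc λ p≡t →
                       x≢v (position-injective (trans p≡t (sym position-v))))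

  greedyRun-reconstructs : ∀ r {t M} → t + r ≡ m → M ≗ matchedBefore t →
                           greedyRun E π r M ≗ matchedBefore m
  greedyRun-reconstructs zero {t} {M} t+0≡m M≗ =
    subst (λ s → M ≗ matchedBefore s) (trans (sym (ℕ.+-identityʳ t)) t+0≡m) M≗
  greedyRun-reconstructs (suc r) {t} t+1+r≡m M≗ with subst (t <_) t+1+r≡m (ℕ.m<m+n t z<s)
  ... | t<m rewrite Step.step t<m M≗ =
    greedyRun-reconstructs r (trans (sym (ℕ.+-suc t r)) t+1+r≡m) (Step.next t<m M≗)

  greedy-reconstructs : greedy E π ≗ just ∘ f
  greedy-reconstructs x =
    trans (greedyRun-reconstructs m refl (λ z → sym (matchedBefore-≮ {0} {z} λ ())) x)
          (matchedBefore-< (toℕ<n (π ⟨$⟩ʳ x)))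

leastImageBound : ∀ {m n} (f : Fin m → Fin n) →
                  ∃ λ k → ImageBelow f k × (∀ {j} → ImageBelow f j → k ≤ j)
leastImageBound f = argmin id (anyUpTo? λ j → all? λ x → toℕ (f x) ℕ.<? j) (toℕ<n ∘ f)

corollary1 : {m n : ℕ} (E : BipGraph m n)
    → (∃ λ (M : Assign m n) → IsMatching E M × Saturating M)
    → ∃ λ (π : Permutation′ m) →
        IsMatching E (greedy E π) × Saturating (greedy E π) ×
        (∃ λ (k : ℕ) → HasOrder (greedy E π) k ×
          (∀ (M : Assign m n) (j : ℕ) → IsMatching E M → HasOrder M j → k ≤ j))
corollary1 E (M₀ , isM₀ , sat₀)
  with f₀ , f₀-sm , _ ← partnerFunction isM₀ sat₀
  with f , f-min@(f-sm , _) ← minimalCost-exists E f₀-sm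
  with π , π-sorts ← sortingPermutation (IsSaturatingMatching.injective f-sm)
  with k , k-bound , k-least ← leastImageBound f
  = π , partnerFunction⇒isMatching f-sm greedy≗f , (λ x → f x , greedy≗f x) ,
    k , (imageBelow⇒orderAtMost greedy≗f k-bound , λ _ → k-least ∘ orderAtMost⇒imageBelow greedy≗f) ,
    optimal
  where
  greedy≗f : greedy E π ≗ just ∘ f
  greedy≗f = GreedyReconstruction.greedy-reconstructs
               f-sm (minimalCost⇒betterNeighboursMatched E f-min) π-sorts

  optimal : ∀ M j → IsMatching E M → HasOrder M j → k ≤ j
  optimal M j isM (order≤j , _)
    with g , g-sm , M≡g ← partnerFunction isM (orderAtMost⇒saturating order≤j)
    = k-least (minimalCost-imageBelow E f-min g-sm (orderAtMost⇒imageBelow M≡g order≤j))
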